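{- Let $\psi(x)$ be a formula with a single free variable and no parameters, $r\subseteq\omega$, and let $M,N$ be sets with $\omega\cup\{r\}\subseteq M\subseteq N$. Then for each $\sigma\in M^{<\omega}$ we have $\sigma\in S^r_\psi(M)$ if and only if $\sigma\in S^r_\psi(N)$. Furthermore, $l_M(\sigma)=l_N(\sigma)$ whenever $\sigma\in S^r_\psi(M)$.
   Context: Object formulas are in the language of first order set theory with $\in$ and $=$, in negation normal form, and may contain sets as parameters. A sequent is a finite sequence of closed formulas; $\varphi,\Gamma$ and $\Gamma,\varphi$ denote prepending/appending. For a set $M\supseteq\omega\cup\{r\}$, the tree $S^r_\psi(M)\subseteq M^{<\omega}$ with labelling $l_M$ is defined by recursion: $\langle\rangle\in S^r_\psi(M)$, $l_M(\langle\rangle)=\langle\neg\psi(r),\neg\forall_{x,y}(\forall_z(z\in x\leftrightarrow z\in y)\to x=y)\rangle$; $\sigma^\frown a$ can be in the tree only if $\sigma$ is. For $\sigma\in S^r_\psi(M)$ with $l_M(\sigma)=\varphi,\Gamma$: if $\varphi$ is a true literal, $\sigma$ is a leaf; if $\varphi$ is a false literal, $\sigma^\frown a\in S^r_\psi(M)$ iff $a=0$, $l_M(\sigma^\frown0)=\Gamma,\varphi$; if $\varphi\equiv\varphi_0\land\varphi_1$, $\sigma^\frown a\in S^r_\psi(M)$ iff $a\in\{0,1\}$, $l_M(\sigma^\frown a)=\Gamma,\varphi,\varphi_a$; if $\varphi\equiv\varphi_0\lor\varphi_1$, $\sigma^\frown a\in S^r_\psi(M)$ iff $a=0$, $l_M(\sigma^\frown0)=\Gamma,\varphi,\varphi_0,\varphi_1$;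 if $\varphi\equiv\forall_x\theta(x)$, $\sigma^\frown a\in S^r_\psi(M)$ iff $a\in M$, $l_M(\sigma^\frown a)=\Gamma,\varphi,\theta(a)$; if $\varphi\equiv\exists_x\theta(x)$ and $\sigma=\langle\sigma_0,\dots,\sigma_{n-1}\rangle$, let $b$ be the first entry of $r,\sigma_0,0,\sigma_1,1,\dots,\sigma_{n-1},n-1,n,n+1,\dots$ such that $\theta(b)$ does not occur in $\Gamma$; then $\sigma^\frown a\in S^r_\psi(M)$ iff $a=0$, $l_M(\sigma^\frown0)=\Gamma,\varphi,\theta(b)$. -}

module Defs where

open import Data.Nat using (ℕ; zero; suc; _+_; _<_)
open import Data.Fin using (Fin; zero; suc)
open import Data.List using (List; []; _∷_; _∷ʳ_; length)
open import Data.List.Relation.Unary.All using (All)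
import Data.List.Membership.Propositional as LM
open import Data.Product using (Σ; _×_; _,_)
open import Data.Sum using (_⊎_)
open import Data.Unit using (⊤)
open import Data.Empty using (⊥)
open import Relation.Nullary using (¬_)
open import Relation.Binary.PropositionalEquality using (_≡_; _≢_)
open import Function.Bundles using (_⇔_)

-- An (abstract) universe of sets: a type of sets with a membership relation,
-- satisfying extensionality (so `=` is identity ≡), together with the
-- von Neumann natural numbers num 0 = ∅, num (n+1) = num n ∪ {num n}.
record SetUniverse : Set₁ where
  field
    V        : Set
    _∈ᵥ_     : V → V → Set
    ext      : ∀ x y → (∀ z → (z ∈ᵥ x) ⇔ (z ∈ᵥ y)) → x ≡ y
    num      : ℕ → V
    num-zero : ∀ z → ¬ (z ∈ᵥ num zero)
    num-suc  : ∀ n z → (z ∈ᵥ num (suc n)) ⇔ ((z ∈ᵥ num n) ⊎ z ≡ num n)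

module Tree (U : SetUniverse) where
  open SetUniverse U public

  data Term (n : ℕ) : Set where
    var : Fin n → Term n
    par : V → Term n

  -- formulas in negation normal form with ≤ n free (de Bruijn) variables
  data Fm (n : ℕ) : Set where
    _∈'_ _∉'_ _≐_ _≉_ : Term n → Term n → Fm n
    _∧'_ _∨'_         : Fm n → Fm n → Fm n
    ∀' ∃'             : Fm (suc n) → Fm n

  ParamFreeT : ∀ {n} → Term n → Set
  ParamFreeT (var _) = ⊤
  ParamFreeT (par _) = ⊥

  ParamFree : ∀ {n} → Fm n → Set
  ParamFree (s ∈' t) = ParamFreeT s × ParamFreeT t
  ParamFree (s ∉' t) = ParamFreeT s × ParamFreeT t
  ParamFree (s ≐ t)  = ParamFreeT s × ParamFreeT t
  ParamFree (s ≉ t)  = ParamFreeT s × ParamFreeT t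
  ParamFree (φ ∧' χ) = ParamFree φ × ParamFree χ
  ParamFree (φ ∨' χ) = ParamFree φ × ParamFree χ
  ParamFree (∀' φ)   = ParamFree φ
  ParamFree (∃' φ)   = ParamFree φ

  wkT : ∀ {n} → Term n → Term (suc n)
  wkT (var i) = var (suc i)
  wkT (par a) = par a

  Subst : ℕ → ℕ → Set
  Subst n m = Fin n → Term m

  liftS : ∀ {n m} → Subst n m → Subst (suc n) (suc m)
  liftS s zero    = var zero
  liftS s (suc i) = wkT (s i)

  substT : ∀ {n m} → Subst n m → Term n → Term m
  substT s (var i) = s i
  substT s (par a) = par a

  subst : ∀ {n m} → Subst n m → Fm n → Fm m
  subst s (x ∈' y) = substT s x ∈' substT s y
  subst s (x ∉' y) = substT s x ∉' substT s y
  subst s (x ≐ y)  = substT s x ≐ substT s y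
  subst s (x ≉ y)  = substT s x ≉ substT s y
  subst s (φ ∧' χ) = subst s φ ∧' subst s χ
  subst s (φ ∨' χ) = subst s φ ∨' subst s χ
  subst s (∀' φ)   = ∀' (subst (liftS s) φ)
  subst s (∃' φ)   = ∃' (subst (liftS s) φ)

  inst : Fm 1 → V → Fm 0
  inst θ a = subst (λ _ → par a) θ

  neg : ∀ {n} → Fm n → Fm n
  neg (x ∈' y) = x ∉' y
  neg (x ∉' y) = x ∈' y
  neg (x ≐ y)  = x ≉ y
  neg (x ≉ y)  = x ≐ y
  neg (φ ∧' χ) = neg φ ∨' neg χ
  neg (φ ∨' χ) = neg φ ∧' neg χ
  neg (∀' φ)   = ∃' (neg φ)
  neg (∃' φ)   = ∀' (neg φ)

  v0 v1 v2 : ∀ {n} → Term (suc (suc (suc n)))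
  v0 = var zero
  v1 = var (suc zero)
  v2 = var (suc (suc zero))

  -- ∀x∀y(∀z(z∈x ↔ z∈y) → x = y) in NNF:
  -- ∀x∀y(∃z((z∈x ∧ z∉y) ∨ (z∈y ∧ z∉x)) ∨ x = y)
  ExtAx : Fm 0
  ExtAx = ∀' (∀' (∃' (((v0 ∈' v2) ∧' (v0 ∉' v1)) ∨' ((v0 ∈' v1) ∧' (v0 ∉' v2)))
                   ∨' (var (suc zero) ≐ var zero)))

  TrueLit : Fm 0 → Set
  TrueLit (par a ∈' par b) = a ∈ᵥ b
  TrueLit (par a ∉' par b) = ¬ (a ∈ᵥ b)
  TrueLit (par a ≐ par b)  = a ≡ b
  TrueLit (par a ≉ par b)  = a ≢ b
  TrueLit _ = ⊥

  FalseLit : Fm 0 → Set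
  FalseLit (par a ∈' par b) = ¬ (a ∈ᵥ b)
  FalseLit (par a ∉' par b) = a ∈ᵥ b
  FalseLit (par a ≐ par b)  = a ≢ b
  FalseLit (par a ≉ par b)  = a ≡ b
  FalseLit _ = ⊥

  Sequent : Set
  Sequent = List (Fm 0)

  -- the finite part  r, σ₀, 0, σ₁, 1, …, σₙ₋₁, n-1  of the candidate sequence
  candPrefix : V → List V → List V
  candPrefix r σ = r ∷ go 0 σ
    where
    go : ℕ → List V → List V
    go k []       = []
    go k (s ∷ ss) = s ∷ num k ∷ go (suc k) ss

  data FirstIn (P : V → Set) : List V → V → Set where
    here  : ∀ {b L}   → ¬ P b → FirstIn P (b ∷ L) b
    there : ∀ {c b L} → P c → FirstIn P L b → FirstIn P (c ∷ L) b

  FirstFrom : (V → Set) → ℕ → V → Set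
  FirstFrom P n b = Σ ℕ λ k → b ≡ num (n + k) × ¬ P b × (∀ j → j < k → P (num (n + j)))

  -- b is the first entry of r,σ₀,0,…,σₙ₋₁,n-1,n,n+1,… not satisfying P
  FirstCand : (V → Set) → V → List V → V → Set
  FirstCand P r σ b =
    FirstIn P (candPrefix r σ) b ⊎ (All P (candPrefix r σ) × FirstFrom P (length σ) b)

  -- Lab ψ r M σ Γ  :⇔  σ ∈ S^r_ψ(M) and l_M(σ) = Γ   (M given as a set of U)
  data Lab (ψ : Fm 1) (r : V) (M : V) : List V → Sequent → Set where
    root  : Lab ψ r M [] (neg (inst ψ r) ∷ neg ExtAx ∷ [])
    false : ∀ {σ φ Γ} → Lab ψ r M σ (φ ∷ Γ) → FalseLit φ →
            Lab ψ r M (σ ∷ʳ num 0) (Γ ∷ʳ φ)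
    and₀  : ∀ {σ φ₀ φ₁ Γ} → Lab ψ r M σ ((φ₀ ∧' φ₁) ∷ Γ) →
            Lab ψ r M (σ ∷ʳ num 0) (Γ ∷ʳ (φ₀ ∧' φ₁) ∷ʳ φ₀)
    and₁  : ∀ {σ φ₀ φ₁ Γ} → Lab ψ r M σ ((φ₀ ∧' φ₁) ∷ Γ) →
            Lab ψ r M (σ ∷ʳ num 1) (Γ ∷ʳ (φ₀ ∧' φ₁) ∷ʳ φ₁)
    or    : ∀ {σ φ₀ φ₁ Γ} → Lab ψ r M σ ((φ₀ ∨' φ₁) ∷ Γ) →
            Lab ψ r M (σ ∷ʳ num 0) (Γ ∷ʳ (φ₀ ∨' φ₁) ∷ʳ φ₀ ∷ʳ φ₁)
    all   : ∀ {σ θ Γ a} → Lab ψ r M σ (∀' θ ∷ Γ) → a ∈ᵥ M →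
            Lab ψ r M (σ ∷ʳ a) (Γ ∷ʳ ∀' θ ∷ʳ inst θ a)
    ex    : ∀ {σ θ Γ b} → Lab ψ r M σ (∃' θ ∷ Γ) →
            FirstCand (λ c → inst θ c LM.∈ Γ) r σ b →
            Lab ψ r M (σ ∷ʳ num 0) (Γ ∷ʳ ∃' θ ∷ʳ inst θ b)

  InTree : Fm 1 → V → V → List V → Set
  InTree ψ r M σ = Σ Sequent (Lab ψ r M σ)

module Submission where

--  * Transfer: M enters the construction only through the ∀-rule, which
--    requires the new entry to lie in M.  Hence a node of S^r_ψ(M) whose
--    entries all lie in N is a node of S^r_ψ(N) with the same label.  Applied
--    from M to N (via M ⊆ N) and from N to M (via σ ∈ M^{<ω}) this gives
--    σ ∈ S^r_ψ(M) ⇔ σ ∈ S^r_ψ(N).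
--
--  * Determinism: within a single tree the label of a node is unique.  The
--    label of σ⌢a is determined by the label of σ, by a, and by σ: the rules
--    are selected by the leading formula of the parent label, the two
--    ∧-children are told apart by 0 ≠ 1, and the witness b of the ∃-rule is
--    the unique first candidate.  Induction along σ then shows uniqueness,
--    and together with transfer l_M(σ) = l_N(σ).

open import Defs
open import Data.Nat using (ℕ)
open import Data.Nat.Properties using (<-cmp)
open import Data.List using (List; []; _∷_; _∷ʳ_; [_])
open import Data.List.Properties using (∷ʳ-injective; ++-conicalʳ)
open import Data.List.Relation.Unary.All using (All; _∷_)
import Data.List.Relation.Unary.All as All
open import Data.List.Relation.Unary.All.Properties using (∷ʳ⁻)
import Data.List.Membership.Propositional as LM
open import Data.Product using (Σ; _×_; _,_; proj₁; proj₂)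
open import Data.Sum using (inj₁; inj₂)
open import Data.Empty using (⊥-elim)
open import Relation.Nullary using (¬_)
open import Relation.Binary using (tri<; tri≈; tri>)
open import Relation.Binary.PropositionalEquality using (_≡_; _≢_; refl; sym; trans; cong)
open import Function.Bundles using (_⇔_; mk⇔; Equivalence)

module TreeFacts (U : SetUniverse) where
  open Tree U

  -- The von Neumann numerals 0 and 1 differ, since 0 ∈ 1 but nothing is in 0;
  -- this separates the two children of a conjunction node.
  num0≢num1 : num 0 ≢ num 1
  num0≢num1 0≡1 =
    num-zero (num 0) (subst0 (Equivalence.from (num-suc 0 (num 0)) (inj₂ refl)))
    where
    subst0 : num 0 ∈ᵥ num 1 → num 0 ∈ᵥ num 0
    subst0 p rewrite 0≡1 = p

  ∷ʳ≢[] : ∀ {A : Set} (xs : List A) x → xs ∷ʳ x ≢ []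
  ∷ʳ≢[] xs x eq with ++-conicalʳ xs [ x ] eq
  ... | ()

  firstIn-unique : ∀ {P L b b′} → FirstIn P L b → FirstIn P L b′ → b ≡ b′
  firstIn-unique (here _)     (here _)     = refl
  firstIn-unique (here ¬Pb)   (there Pb _) = ⊥-elim (¬Pb Pb)
  firstIn-unique (there Pb _) (here ¬Pb)   = ⊥-elim (¬Pb Pb)
  firstIn-unique (there _ x)  (there _ y)  = firstIn-unique x y

  firstIn-¬All : ∀ {P L b} → FirstIn P L b → ¬ All P L
  firstIn-¬All (here ¬Pb)  (Pb ∷ _)  = ¬Pb Pb
  firstIn-¬All (there _ x) (_ ∷ Ps) = firstIn-¬All x Ps

  -- The first numeral n + k failing P is unique: a smaller k would be passed.
  firstFrom-unique : ∀ {P n b b′} → FirstFrom P n b → FirstFrom P n b′ → b ≡ b′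
  firstFrom-unique (k , refl , ¬Pb , below) (k′ , refl , ¬Pb′ , below′) with <-cmp k k′
  ... | tri< k<k′ _ _    = ⊥-elim (¬Pb (below′ k k<k′))
  ... | tri≈ _ refl _    = refl
  ... | tri> _ _ k′<k    = ⊥-elim (¬Pb′ (below k′ k′<k))

  firstCand-unique : ∀ {P r σ b b′} → FirstCand P r σ b → FirstCand P r σ b′ → b ≡ b′
  firstCand-unique (inj₁ x)       (inj₁ y)       = firstIn-unique x y
  firstCand-unique (inj₁ x)       (inj₂ (Ps , _)) = ⊥-elim (firstIn-¬All x Ps)
  firstCand-unique (inj₂ (Ps , _)) (inj₁ y)       = ⊥-elim (firstIn-¬All y Ps)
  firstCand-unique (inj₂ (_ , x)) (inj₂ (_ , y)) = firstFrom-unique x y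

  -- Transfer: a node of S^r_ψ(M) all of whose entries lie in N is a node of
  -- S^r_ψ(N) with the same label (only the ∀-rule looks at the ambient set).
  transfer : ∀ {ψ r M N σ Γ} → All (_∈ᵥ N) σ → Lab ψ r M σ Γ → Lab ψ r N σ Γ
  transfer σ∈N root         = root
  transfer σ∈N (false d f)  = false (transfer (proj₁ (∷ʳ⁻ σ∈N)) d) f
  transfer σ∈N (and₀ d)     = and₀ (transfer (proj₁ (∷ʳ⁻ σ∈N)) d)
  transfer σ∈N (and₁ d)     = and₁ (transfer (proj₁ (∷ʳ⁻ σ∈N)) d)
  transfer σ∈N (or d)       = or (transfer (proj₁ (∷ʳ⁻ σ∈N)) d)
  transfer σ∈N (all d _)    = all (transfer (proj₁ (∷ʳ⁻ σ∈N)) d) (proj₂ (∷ʳ⁻ σ∈N))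
  transfer σ∈N (ex d b)     = ex (transfer (proj₁ (∷ʳ⁻ σ∈N)) d) b

  -- One step of the construction: the child σ⌢a of a node σ labelled Γ gets
  -- the label Δ.  The entry a is kept as an index constrained by equations,
  -- so that distinct rules can be compared.
  data Step (r : V) (σ : List V) : Sequent → V → Sequent → Set where
    false : ∀ {φ Γ a} → a ≡ num 0 → FalseLit φ → Step r σ (φ ∷ Γ) a (Γ ∷ʳ φ)
    and₀  : ∀ {φ₀ φ₁ Γ a} → a ≡ num 0 →
            Step r σ ((φ₀ ∧' φ₁) ∷ Γ) a (Γ ∷ʳ (φ₀ ∧' φ₁) ∷ʳ φ₀)
    and₁  : ∀ {φ₀ φ₁ Γ a} → a ≡ num 1 →
            Step r σ ((φ₀ ∧' φ₁) ∷ Γ) a (Γ ∷ʳ (φ₀ ∧' φ₁) ∷ʳ φ₁)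
    or    : ∀ {φ₀ φ₁ Γ a} → a ≡ num 0 →
            Step r σ ((φ₀ ∨' φ₁) ∷ Γ) a (Γ ∷ʳ (φ₀ ∨' φ₁) ∷ʳ φ₀ ∷ʳ φ₁)
    all   : ∀ {θ Γ a} → Step r σ (∀' θ ∷ Γ) a (Γ ∷ʳ ∀' θ ∷ʳ inst θ a)
    ex    : ∀ {θ Γ a b} → a ≡ num 0 → FirstCand (λ c → inst θ c LM.∈ Γ) r σ b →
            Step r σ (∃' θ ∷ Γ) a (Γ ∷ʳ ∃' θ ∷ʳ inst θ b)

  -- A step is deterministic: parent label and new entry fix the child label.
  -- Compound formulas are not false literals, and 0 ≠ 1 separates the ∧-rules.
  step-unique : ∀ {r σ Γ a Δ Δ′} → Step r σ Γ a Δ → Step r σ Γ a Δ′ → Δ ≡ Δ′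
  step-unique (false _ _) (false _ _) = refl
  step-unique (false _ ()) (and₀ _)
  step-unique (false _ ()) (and₁ _)
  step-unique (false _ ()) (or _)
  step-unique (false _ ()) all
  step-unique (false _ ()) (ex _ _)
  step-unique (and₀ _) (false _ ())
  step-unique (and₁ _) (false _ ())
  step-unique (or _) (false _ ())
  step-unique all (false _ ())
  step-unique (ex _ _) (false _ ())
  step-unique (and₀ _) (and₀ _) = refl
  step-unique (and₀ a≡0) (and₁ a≡1) = ⊥-elim (num0≢num1 (trans (sym a≡0) a≡1))
  step-unique (and₁ a≡1) (and₀ a≡0) = ⊥-elim (num0≢num1 (trans (sym a≡0) a≡1))
  step-unique (and₁ _) (and₁ _) = refl
  step-unique (or _) (or _) = refl
  step-unique all all = refl
  step-unique (ex _ b) (ex _ b′) = cong (λ c → _ ∷ʳ _ ∷ʳ inst _ c) (firstCand-unique b b′)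

  parent : ∀ {ψ r M σ′ σ a Δ} → Lab ψ r M σ′ Δ → σ′ ≡ σ ∷ʳ a →
           Σ Sequent λ Γ → Lab ψ r M σ Γ × Step r σ Γ a Δ
  parent root eq = ⊥-elim (∷ʳ≢[] _ _ (sym eq))
  parent (false d f) eq with ∷ʳ-injective _ _ eq
  ... | refl , a≡0 = _ , d , false (sym a≡0) f
  parent (and₀ d) eq with ∷ʳ-injective _ _ eq
  ... | refl , a≡0 = _ , d , and₀ (sym a≡0)
  parent (and₁ d) eq with ∷ʳ-injective _ _ eq
  ... | refl , a≡1 = _ , d , and₁ (sym a≡1)
  parent (or d) eq with ∷ʳ-injective _ _ eq
  ... | refl , a≡0 = _ , d , or (sym a≡0)
  parent (all d _) eq with ∷ʳ-injective _ _ eq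
  ... | refl , refl = _ , d , all
  parent (ex d b) eq with ∷ʳ-injective _ _ eq
  ... | refl , a≡0 = _ , d , ex (sym a≡0) b

  root-label : ∀ {ψ r M σ Γ} → Lab ψ r M σ Γ → σ ≡ [] →
               Γ ≡ neg (inst ψ r) ∷ neg ExtAx ∷ []
  root-label root _ = refl
  root-label (false _ _) eq = ⊥-elim (∷ʳ≢[] _ _ eq)
  root-label (and₀ _)    eq = ⊥-elim (∷ʳ≢[] _ _ eq)
  root-label (and₁ _)    eq = ⊥-elim (∷ʳ≢[] _ _ eq)
  root-label (or _)      eq = ⊥-elim (∷ʳ≢[] _ _ eq)
  root-label (all _ _)   eq = ⊥-elim (∷ʳ≢[] _ _ eq)
  root-label (ex _ _)    eq = ⊥-elim (∷ʳ≢[] _ _ eq)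

  child-unique : ∀ {ψ r M σ a Γ Δ Δ′} → Step r σ Γ a Δ →
                 (∀ {Γ′} → Lab ψ r M σ Γ′ → Γ ≡ Γ′) →
                 Lab ψ r M (σ ∷ʳ a) Δ′ → Δ ≡ Δ′
  child-unique step parent-unique d′ with parent d′ refl
  ... | _ , d″ , step′ with parent-unique d″
  ... | refl = step-unique step step′

  label-unique : ∀ {ψ r M σ Γ Γ′} → Lab ψ r M σ Γ → Lab ψ r M σ Γ′ → Γ ≡ Γ′
  label-unique root d′         = sym (root-label d′ refl)
  label-unique (false d f) d′  = child-unique (false refl f) (label-unique d) d′
  label-unique (and₀ d) d′     = child-unique (and₀ refl) (label-unique d) d′
  label-unique (and₁ d) d′     = child-unique (and₁ refl) (label-unique d) d′
  label-unique (or d) d′       = child-unique (or refl) (label-unique d) d′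
  label-unique (all d _) d′    = child-unique all (label-unique d) d′
  label-unique (ex d b) d′     = child-unique (ex refl b) (label-unique d) d′

-- The lemma: transfer in both directions gives the equivalence, and the
-- labels agree because both are labels of σ in S^r_ψ(N).
lemma3p1 : (U : SetUniverse) → let open Tree U in
    (ψ : Fm 1) → ParamFree ψ →
    (r : V) → (∀ z → z ∈ᵥ r → Σ ℕ (λ n → z ≡ num n)) →
    (M N : V) → (∀ n → num n ∈ᵥ M) → r ∈ᵥ M → (∀ x → x ∈ᵥ M → x ∈ᵥ N) →
    (σ : List V) → All (λ a → a ∈ᵥ M) σ →
    (InTree ψ r M σ ⇔ InTree ψ r N σ)
    × (∀ Γ Γ′ → Lab ψ r M σ Γ → Lab ψ r N σ Γ′ → Γ ≡ Γ′)
lemma3p1 U ψ _ r _ M N _ _ M⊆N σ σ∈M =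
    mk⇔ (λ { (Γ , d) → Γ , transfer σ∈N d }) (λ { (Γ , d) → Γ , transfer σ∈M d })
  , λ Γ Γ′ d d′ → label-unique (transfer σ∈N d) d′
  where
  open Tree U
  open TreeFacts U
  σ∈N : All (_∈ᵥ N) σ
  σ∈N = All.map (M⊆N _) σ∈M
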